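{- Let $\mathbb{A}$ be an infinite alphabet of independent indeterminates, and work with formal power series in $z$ with coefficients in the field of fractions of the ring generated by the complete functions $S_i(\mathbb{A})$. Let $f_{ -1}=1$, $f_0=\sigma_z(\mathbb{A})$, and let $f_1,f_2,\dots$ be the successive remainders of the Euclidean division (as defined in the context) of $1$ by $\sigma_z(\mathbb{A})$; write $f_k=\sigma_z(\mathbb{A}^k)$ (so $\mathbb{A}^0=\mathbb{A}$). Then for every integer $k\ge1$, $$ S_{k^{k+1}}(\mathbb{A})\,\sigma_z(\mathbb{A}^k)=\sum_{i=0}^\infty z^i\, S_{k+i,k^k}(\mathbb{A}). $$
   Context: For an alphabet $\mathbb{A}$, $\sigma_z(\mathbb{A}):=\prod_{a\in\mathbb{A}}(1-za)^{ -1}=\sum_{i\ge0} z^i S_i(\mathbb{A})$, with $S_0=1$ and $S_i=0$ for $i<0$. For a sequence of integers $\lambda=(\lambda_1,\dots,\lambda_\ell)$, $S_\lambda(\mathbb{A})=\det\bigl(S_{\lambda_i+j-i}(\mathbb{A})\bigr)_{1\le i,j\le\ell}$. Exponent notation: $k^{r}$ means $r$ parts equal to $k$; so $k^{k+1}=(k,\dots,k)$ with $k+1$ parts, and $(k+i,k^k)=(k+i,k,\dots,k)$ with $k$ parts equal to $k$ after the first. Any unitary series $1+c_1z+\cdots$ is formally written $\sigma_z(\mathbb{C})$ for a (formal) alphabet $\mathbb{C}$. Euclidean division of series: given unitary series $f_{ -1},f_0$, one defines recursively for $k\ge 0$ the unitary series $f_{k+1}$ and scalars $\alpha_k,\beta_k$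 ($\beta_k\ne0$) as the unique ones with $f_{k-1}(z)=(1+\alpha_kz)f_k(z)+\beta_kz^2f_{k+1}(z)$; the $f_k$, $k\ge1$, are the successive remainders. -}

module Defs where

open import Level using (Level; _⊔_)
open import Data.Nat using (ℕ; zero; suc)
open import Data.Fin using (Fin; zero; suc; toℕ; punchIn)
open import Data.Integer using (ℤ; +_; -[1+_]) renaming (_+_ to _+ℤ_; _-_ to _-ℤ_)
open import Data.Product using (Σ)
open import Relation.Nullary using (¬_)
open import Algebra.Bundles using (CommutativeRing)

record Field (c ℓ : Level) : Set (Level.suc (c ⊔ ℓ)) where
  field
    commutativeRing : CommutativeRing c ℓ
  open CommutativeRing commutativeRing public
  field
    1≉0     : ¬ (1# ≈ 0#)
    inverse : ∀ x → ¬ (x ≈ 0#) → Σ Carrier (λ y → (x * y) ≈ 1#)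

module FieldDefs {c ℓ : Level} (F : Field c ℓ) where
  open Field F using (Carrier; _≈_; _+_; _*_; -_; 0#; 1#)

  -- formal power series in z over F, given by their coefficient sequences
  Series : Set c
  Series = ℕ → Carrier

  _≋_ : Series → Series → Set ℓ
  f ≋ g = ∀ n → f n ≈ g n

  Unitary : Series → Set ℓ
  Unitary f = f 0 ≈ 1#

  one : Series
  one zero    = 1#
  one (suc _) = 0#

  _⊕_ : Series → Series → Series
  (f ⊕ g) n = f n + g n

  onePlusZ* : Carrier → Series → Series
  onePlusZ* a f zero    = f zero
  onePlusZ* a f (suc n) = f (suc n) + a * f n

  bz²* : Carrier → Series → Series
  bz²* b f zero          = 0#
  bz²* b f (suc zero)    = 0#
  bz²* b f (suc (suc n)) = b * f n

  sumFin : (n : ℕ) → (Fin n → Carrier) → Carrier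
  sumFin zero    g = 0#
  sumFin (suc n) g = g zero + sumFin n (λ j → g (suc j))

  signed : ℕ → Carrier → Carrier
  signed zero    x = x
  signed (suc m) x = - signed m x

  det : (n : ℕ) → (Fin n → Fin n → Carrier) → Carrier
  det zero    M = 1#
  det (suc n) M =
    sumFin (suc n) (λ j → signed (toℕ j)
      (M zero j * det n (λ a b → M (suc a) (punchIn j b))))

  -- Complete functions S_i extended to integer indices, from the values
  -- s i = S_{i+1} (i ≥ 0); S_0 = 1 and S_i = 0 for i < 0.
  Sℤ : (ℕ → Carrier) → ℤ → Carrier
  Sℤ s (+ zero)    = 1#
  Sℤ s (+ (suc i)) = s i
  Sℤ s -[1+ _ ]    = 0#

  σ : (ℕ → Carrier) → Series
  σ s n = Sℤ s (+ n)

  schur : (ℕ → Carrier) → (l : ℕ) → (Fin l → ℕ) → Carrier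
  schur s l λp = det l (λ i j → Sℤ s ((+ λp i +ℤ + toℕ j) -ℤ + toℕ i))

  rect : (k : ℕ) → Fin (suc k) → ℕ
  rect k _ = k

  hook : (k i : ℕ) → Fin (suc k) → ℕ
  hook k i zero    = k Data.Nat.+ i
  hook k i (suc _) = k

  -- Euclidean division data: g m = f_{m-1}, so g 0 = f_{-1}, g 1 = f_0.
  -- For every m ≥ 0 (i.e. k = m in the paper's indexing):
  --   f_{k-1} = (1 + α_k z) f_k + β_k z² f_{k+1},  β_k ≠ 0, all f unitary.
  record EuclidDivision (f₋₁ f₀ : Series) : Set (c ⊔ ℓ) where
    field
      g       : ℕ → Series
      α β     : ℕ → Carrier
      g0      : g 0 ≋ f₋₁
      g1      : g 1 ≋ f₀
      unitary : ∀ m → Unitary (g m)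
      β≉0     : ∀ m → ¬ (β m ≈ 0#)
      step    : ∀ m → g m ≋ (onePlusZ* (α m) (g (suc m)) ⊕ bz²* (β m) (g (suc (suc m))))

-- For every m the coefficients of z^m f_m are fixed linear combinations of complete functions:
-- [z^n] z^m f_m = Σ_{j ≤ m} a_j S_{n+j} for all n ≥ 0. This holds for m = 0, 1 and propagates along
-- the division step multiplied by z^m, which expresses z^(m+2) f_(m+1) through z^m f_(m-1) and
-- z^(m+1) f_m. For m = k, the vector a is orthogonal to the rows (S_n, …, S_(n+k)), n < k, of the
-- matrix of S_(k^(k+1)), since they give the coefficients of z^n in z^k f_k; it pairs to f_k(0) = 1 with
-- its first row and to f_k(i) with the first row of the matrix of S_(k+i,k^k). Cramer's rule gives
-- det(x; R) (a · y) = det(y; R) (a · x) whenever a is orthogonal to the rows of R.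

module Submission where

open import Defs
open import Level using (Level; _⊔_)
open import Data.Nat as ℕ using (ℕ; zero; suc; _<_; _≤_; _≥_; _∸_; z≤n; s≤s)
import Data.Nat.Properties as ℕ
open import Data.Fin as Fin using (Fin; zero; suc; toℕ; punchIn; punchOut; inject₁)
import Data.Fin.Properties as Fin
open import Data.Integer as ℤ using (+_)
import Data.Integer.Properties as ℤ
open import Data.Vec.Functional using (updateAt; _∷_; tail)
open import Data.Vec.Functional.Properties using (updateAt-updates; updateAt-minimal)
open import Data.Product using (Σ; _,_; _×_; proj₁; proj₂)
open import Data.Sum using (_⊎_; inj₁; inj₂)
open import Data.Empty using (⊥-elim)
open import Relation.Nullary using (yes; no)
open import Relation.Binary.PropositionalEquality as ≡ using (_≡_; _≢_)
open import Relation.Binary.Definitions using (tri<; tri≈; tri>)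

module FiniteSums {c ℓ : Level} (F : Field c ℓ) where
  open Field F hiding (zero)
  open FieldDefs F using (sumFin)
  open import Algebra.Properties.Ring ring using (-0#≈0#; -‿+-comm)
  open import Algebra.Properties.CommutativeSemigroup +-commutativeSemigroup using (interchange)
  open import Relation.Binary.Reasoning.Setoid setoid

  sumFin-cong : ∀ n {f g : Fin n → Carrier} → (∀ j → f j ≈ g j) → sumFin n f ≈ sumFin n g
  sumFin-cong zero    f≈g = refl
  sumFin-cong (suc n) f≈g = +-cong (f≈g zero) (sumFin-cong n (λ j → f≈g (suc j)))

  sumFin-zero : ∀ n {f : Fin n → Carrier} → (∀ j → f j ≈ 0#) → sumFin n f ≈ 0#
  sumFin-zero zero    f≈0 = refl
  sumFin-zero (suc n) f≈0 = trans (+-cong (f≈0 zero) (sumFin-zero n (λ j → f≈0 (suc j)))) (+-identityʳ 0#)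

  sumFin-+ : ∀ n (f g : Fin n → Carrier) → sumFin n (λ j → f j + g j) ≈ sumFin n f + sumFin n g
  sumFin-+ zero    f g = sym (+-identityʳ 0#)
  sumFin-+ (suc n) f g = trans (+-congˡ (sumFin-+ n _ _)) (interchange _ _ _ _)

  sumFin-*ˡ : ∀ n x (f : Fin n → Carrier) → sumFin n (λ j → x * f j) ≈ x * sumFin n f
  sumFin-*ˡ zero    x f = sym (zeroʳ x)
  sumFin-*ˡ (suc n) x f = trans (+-congˡ (sumFin-*ˡ n x _)) (sym (distribˡ x _ _))

  sumFin-neg : ∀ n (f : Fin n → Carrier) → sumFin n (λ j → - f j) ≈ - sumFin n f
  sumFin-neg zero    f = sym -0#≈0#
  sumFin-neg (suc n) f = trans (+-congˡ (sumFin-neg n _)) (-‿+-comm _ _)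

  sumFin-linear : ∀ n x y (f g : Fin n → Carrier) →
    sumFin n (λ j → x * f j + y * g j) ≈ x * sumFin n f + y * sumFin n g
  sumFin-linear n x y f g = trans (sumFin-+ n _ _) (+-cong (sumFin-*ˡ n x f) (sumFin-*ˡ n y g))

  sumFin-single : ∀ n (f : Fin n → Carrier) p → (∀ j → j ≢ p → f j ≈ 0#) → sumFin n f ≈ f p
  sumFin-single (suc n) f zero    off = trans (+-congˡ (sumFin-zero n (λ j → off (suc j) λ ()))) (+-identityʳ _)
  sumFin-single (suc n) f (suc p) off = trans (+-congʳ (off zero λ ())) (trans (+-identityˡ _)
    (sumFin-single n (λ j → f (suc j)) p (λ j j≢p → off (suc j) (λ eq → j≢p (Fin.suc-injective eq)))))

  sumFin-adjacentPair : ∀ n (f : Fin (suc (suc n)) → Carrier) (p : Fin (suc n)) →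
    (∀ j → j ≢ inject₁ p → j ≢ suc p → f j ≈ 0#) → f (inject₁ p) + f (suc p) ≈ 0# →
    sumFin (suc (suc n)) f ≈ 0#
  sumFin-adjacentPair n f zero off pair = begin
    f zero + (f (suc zero) + sumFin n (λ j → f (suc (suc j))))  ≈⟨ sym (+-assoc _ _ _) ⟩
    (f zero + f (suc zero)) + sumFin n (λ j → f (suc (suc j)))
      ≈⟨ +-cong pair (sumFin-zero n (λ j → off (suc (suc j)) (λ ()) (λ ()))) ⟩
    0# + 0#                                                     ≈⟨ +-identityʳ 0# ⟩
    0#                                                          ∎
  sumFin-adjacentPair (suc n) f (suc p) off pair = trans
    (+-cong (off zero (λ ()) (λ ()))
            (sumFin-adjacentPair n (λ j → f (suc j)) p
              (λ j ≢p ≢sp → off (suc j) (λ eq → ≢p (Fin.suc-injective eq)) (λ eq → ≢sp (Fin.suc-injective eq)))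
              pair))
    (+-identityʳ 0#)

  infix 7 _·_
  _·_ : ∀ {n} → (Fin n → Carrier) → (Fin n → Carrier) → Carrier
  _·_ {n} u v = sumFin n (λ l → u l * v l)

  sumBelow : ℕ → (ℕ → Carrier) → Carrier
  sumBelow N h = sumFin N (λ l → h (toℕ l))

  sumBelow-pad : ∀ N h → h N ≈ 0# → sumBelow (suc N) h ≈ sumBelow N h
  sumBelow-pad zero    h h0≈0 = trans (+-congʳ h0≈0) (+-identityʳ 0#)
  sumBelow-pad (suc N) h hN≈0 = +-congˡ (sumBelow-pad N (λ j → h (suc j)) hN≈0)

module Determinant {c ℓ : Level} (F : Field c ℓ) where
  open Field F hiding (zero)
  open FieldDefs F
  open FiniteSums F
  open import Algebra.Properties.Ring ring using (-‿distribʳ-*; -0#≈0#; -‿+-comm; +-inverseˡ-unique)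
  open import Algebra.Properties.CommutativeSemigroup *-commutativeSemigroup using (x∙yz≈y∙xz; x∙yz≈z∙xy)
  open import Relation.Binary.Reasoning.Setoid setoid

  signed-cong : ∀ m {x y} → x ≈ y → signed m x ≈ signed m y
  signed-cong zero    x≈y = x≈y
  signed-cong (suc m) x≈y = -‿cong (signed-cong m x≈y)

  signed-+ : ∀ m x y → signed m (x + y) ≈ signed m x + signed m y
  signed-+ zero    x y = refl
  signed-+ (suc m) x y = trans (-‿cong (signed-+ m x y)) (sym (-‿+-comm _ _))

  signed-*ˡ : ∀ m x y → signed m (x * y) ≈ x * signed m y
  signed-*ˡ zero    x y = refl
  signed-*ˡ (suc m) x y = trans (-‿cong (signed-*ˡ m x y)) (-‿distribʳ-* x (signed m y))

  signed-linear : ∀ m x y u v → signed m (x * u + y * v) ≈ x * signed m u + y * signed m v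
  signed-linear m x y u v = trans (signed-+ m _ _) (+-cong (signed-*ˡ m x u) (signed-*ˡ m y v))

  signed-0# : ∀ m → signed m 0# ≈ 0#
  signed-0# zero    = refl
  signed-0# (suc m) = trans (-‿cong (signed-0# m)) -0#≈0#

  Matrix : ℕ → Set c
  Matrix n = Fin n → Fin n → Carrier

  column : ∀ {n} → Matrix n → Fin n → Fin n → Carrier
  column M j i = M i j

  minor : ∀ {n} → Matrix (suc n) → Fin (suc n) → Matrix n
  minor M j a b = M (suc a) (punchIn j b)

  AgreeOffColumn : ∀ {n} → Fin n → Matrix n → Matrix n → Set ℓ
  AgreeOffColumn j M N = ∀ i l → l ≢ j → M i l ≈ N i l

  replaceColumn : ∀ {n} → Fin n → (Fin n → Carrier) → Matrix n → Matrix n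
  replaceColumn j w M i = updateAt (M i) j (λ _ → w i)

  replaceColumn-at : ∀ {n} j w (M : Matrix n) i → replaceColumn j w M i j ≈ w i
  replaceColumn-at j w M i = reflexive (updateAt-updates j (M i))

  replaceColumn-off : ∀ {n} j w (M : Matrix n) → AgreeOffColumn j (replaceColumn j w M) M
  replaceColumn-off j w M i l l≢j = reflexive (updateAt-minimal l j (M i) l≢j)

  det-cong : ∀ n {M N : Matrix n} → (∀ i j → M i j ≈ N i j) → det n M ≈ det n N
  det-cong zero    M≈N = refl
  det-cong (suc n) M≈N = sumFin-cong (suc n) λ j → signed-cong (toℕ j)
    (*-cong (M≈N zero j) (det-cong n (λ a b → M≈N (suc a) (punchIn j b))))

  minor-agreeOff : ∀ {n} {M N : Matrix (suc n)} j → AgreeOffColumn j M N → ∀ a b → minor M j a b ≈ minor N j a b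
  minor-agreeOff j M≈N a b = M≈N (suc a) (punchIn j b) (Fin.punchInᵢ≢i j b)

  minor-agreeOffColumn : ∀ {n} {M N : Matrix (suc n)} {j l} (l≢j : l ≢ j) →
    AgreeOffColumn j M N → AgreeOffColumn (punchOut l≢j) (minor M l) (minor N l)
  minor-agreeOffColumn {l = l} l≢j M≈N a b b≢ = M≈N (suc a) (punchIn l b) λ eq →
    b≢ (Fin.punchIn-injective l b _ (≡.trans eq (≡.sym (Fin.punchIn-punchOut l≢j))))

  laplaceTerm : ∀ {n} → Matrix (suc n) → Fin (suc n) → Carrier
  laplaceTerm {n} M l = signed (toℕ l) (M zero l * det n (minor M l))

  det-linearColumn : ∀ n (j : Fin n) x y (A B M : Matrix n) → AgreeOffColumn j M A → AgreeOffColumn j M B →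
    (∀ i → M i j ≈ x * A i j + y * B i j) → det n M ≈ x * det n A + y * det n B
  det-linearColumn (suc n) j x y A B M M≈A M≈B Mj =
    trans (sumFin-cong (suc n) term) (sumFin-linear (suc n) x y (laplaceTerm A) (laplaceTerm B))
    where
    term : ∀ l → laplaceTerm M l ≈ x * laplaceTerm A l + y * laplaceTerm B l
    term l with l Fin.≟ j
    ... | yes ≡.refl = trans (signed-cong (toℕ l) (begin
      M zero l * det n (minor M l)
        ≈⟨ *-congʳ (Mj zero) ⟩
      (x * A zero l + y * B zero l) * det n (minor M l)
        ≈⟨ distribʳ _ _ _ ⟩
      (x * A zero l) * det n (minor M l) + (y * B zero l) * det n (minor M l)
        ≈⟨ +-cong (*-assoc _ _ _) (*-assoc _ _ _) ⟩
      x * (A zero l * det n (minor M l)) + y * (B zero l * det n (minor M l))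
        ≈⟨ +-cong (*-congˡ (*-congˡ (det-cong n (minor-agreeOff l M≈A))))
                  (*-congˡ (*-congˡ (det-cong n (minor-agreeOff l M≈B)))) ⟩
      x * (A zero l * det n (minor A l)) + y * (B zero l * det n (minor B l)) ∎))
      (signed-linear (toℕ l) x y _ _)
    ... | no l≢j = trans (signed-cong (toℕ l) (begin
      M zero l * det n (minor M l)
        ≈⟨ *-congˡ (det-linearColumn n (punchOut l≢j) x y (minor A l) (minor B l) (minor M l)
             (minor-agreeOffColumn l≢j M≈A) (minor-agreeOffColumn l≢j M≈B)
             (λ a → ≡.subst (λ t → M (suc a) t ≈ x * A (suc a) t + y * B (suc a) t)
                       (≡.sym (Fin.punchIn-punchOut l≢j)) (Mj (suc a)))) ⟩
      M zero l * (x * det n (minor A l) + y * det n (minor B l))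
        ≈⟨ distribˡ _ _ _ ⟩
      M zero l * (x * det n (minor A l)) + M zero l * (y * det n (minor B l))
        ≈⟨ +-cong (x∙yz≈y∙xz _ _ _) (x∙yz≈y∙xz _ _ _) ⟩
      x * (M zero l * det n (minor A l)) + y * (M zero l * det n (minor B l))
        ≈⟨ +-cong (*-congˡ (*-congʳ (M≈A zero l l≢j))) (*-congˡ (*-congʳ (M≈B zero l l≢j))) ⟩
      x * (A zero l * det n (minor A l)) + y * (B zero l * det n (minor B l)) ∎))
      (signed-linear (toℕ l) x y _ _)

  det-zeroColumn : ∀ n (M : Matrix n) j → (∀ i → M i j ≈ 0#) → det n M ≈ 0#
  det-zeroColumn n M j Mj≈0 = trans
    (det-linearColumn n j 0# 0# M M M (λ _ _ _ → refl) (λ _ _ _ → refl) (λ i → trans (Mj≈0 i) (sym zero-combination)))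
    zero-combination
    where
    zero-combination : ∀ {u v} → 0# * u + 0# * v ≈ 0#
    zero-combination = trans (+-cong (zeroˡ _) (zeroˡ _)) (+-identityʳ 0#)

  det-additiveColumn : ∀ n (j : Fin n) (A B M : Matrix n) → AgreeOffColumn j M A → AgreeOffColumn j M B →
    (∀ i → M i j ≈ A i j + B i j) → det n M ≈ det n A + det n B
  det-additiveColumn n j A B M M≈A M≈B Mj = trans
    (det-linearColumn n j 1# 1# A B M M≈A M≈B (λ i → trans (Mj i) (sym (+-cong (*-identityˡ _) (*-identityˡ _)))))
    (+-cong (*-identityˡ _) (*-identityˡ _))

  replaceColumn-agreeOff : ∀ {n} j w w' (M : Matrix n) → AgreeOffColumn j (replaceColumn j w M) (replaceColumn j w' M)
  replaceColumn-agreeOff j w w' M i l l≢j = trans (replaceColumn-off j w M i l l≢j) (sym (replaceColumn-off j w' M i l l≢j))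

  replaceColumn-preservesAgreement : ∀ {n} {M N : Matrix n} j k w → AgreeOffColumn k M N →
    AgreeOffColumn k (replaceColumn j w M) (replaceColumn j w N)
  replaceColumn-preservesAgreement {M = M} {N} j k w M≈N i l l≢k with l Fin.≟ j
  ... | yes ≡.refl = trans (replaceColumn-at l w M i) (sym (replaceColumn-at l w N i))
  ... | no l≢j = trans (replaceColumn-off j w M i l l≢j) (trans (M≈N i l l≢k) (sym (replaceColumn-off j w N i l l≢j)))

  punchIn-adjacent : ∀ {n} (p b : Fin (suc n)) →
    punchIn (inject₁ p) b ≡ punchIn (suc p) b ⊎ (punchIn (inject₁ p) b ≡ suc p × punchIn (suc p) b ≡ inject₁ p)
  punchIn-adjacent zero    zero    = inj₂ (≡.refl , ≡.refl)
  punchIn-adjacent zero    (suc b) = inj₁ ≡.refl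
  punchIn-adjacent (suc p) zero    = inj₁ ≡.refl
  punchIn-adjacent {suc n} (suc p) (suc b) with punchIn-adjacent p b
  ... | inj₁ eq         = inj₁ (≡.cong suc eq)
  ... | inj₂ (e₁ , e₂) = inj₂ (≡.cong suc e₁ , ≡.cong suc e₂)

  punchOut-adjacent : ∀ {n} (j : Fin (suc (suc n))) (p : Fin (suc n)) → j ≢ inject₁ p → j ≢ suc p →
    Σ (Fin n) λ q → punchIn j (inject₁ q) ≡ inject₁ p × punchIn j (suc q) ≡ suc p
  punchOut-adjacent zero zero ≢p _ = ⊥-elim (≢p ≡.refl)
  punchOut-adjacent zero (suc p) _ _ = p , ≡.refl , ≡.refl
  punchOut-adjacent (suc zero) zero _ ≢sp = ⊥-elim (≢sp ≡.refl)
  punchOut-adjacent {suc n} (suc (suc j)) zero _ _ = zero , ≡.refl , ≡.refl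
  punchOut-adjacent {suc n} (suc j) (suc p) ≢p ≢sp
    with punchOut-adjacent j p (λ eq → ≢p (≡.cong suc eq)) (λ eq → ≢sp (≡.cong suc eq))
  ... | q , e₁ , e₂ = suc q , ≡.cong suc e₁ , ≡.cong suc e₂

  inject₁≢suc : ∀ {n} (p : Fin n) → inject₁ p ≢ suc p
  inject₁≢suc p eq = ℕ.<⇒≢ (ℕ.n<1+n (toℕ p)) (≡.trans (≡.sym (Fin.toℕ-inject₁ p)) (≡.cong toℕ eq))

  AdjacentEqualColumns : ∀ {n} → Matrix (suc (suc n)) → Fin (suc n) → Set ℓ
  AdjacentEqualColumns M p = ∀ i → M i (inject₁ p) ≈ M i (suc p)

  det-adjacentEqualColumns : ∀ n (M : Matrix (suc (suc n))) p → AdjacentEqualColumns M p → det (suc (suc n)) M ≈ 0#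
  det-minor-adjacentEqualColumns : ∀ n (M : Matrix (suc (suc n))) p j → j ≢ inject₁ p → j ≢ suc p →
    AdjacentEqualColumns M p → det (suc n) (minor M j) ≈ 0#

  det-adjacentEqualColumns n M p M≈ = sumFin-adjacentPair n (laplaceTerm M) p others pair
    where
    others : ∀ j → j ≢ inject₁ p → j ≢ suc p → laplaceTerm M j ≈ 0#
    others j ≢p ≢sp = trans (signed-cong (toℕ j)
      (trans (*-congˡ (det-minor-adjacentEqualColumns n M p j ≢p ≢sp M≈)) (zeroʳ _))) (signed-0# (toℕ j))
    sameMinor : ∀ a b → minor M (inject₁ p) a b ≈ minor M (suc p) a b
    sameMinor a b with punchIn-adjacent p b
    ... | inj₁ eq         = reflexive (≡.cong (M (suc a)) eq)
    ... | inj₂ (e₁ , e₂) =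
      ≡.subst₂ (λ u v → M (suc a) u ≈ M (suc a) v) (≡.sym e₁) (≡.sym e₂) (sym (M≈ (suc a)))
    pair : laplaceTerm M (inject₁ p) + laplaceTerm M (suc p) ≈ 0#
    pair = begin
      laplaceTerm M (inject₁ p) + laplaceTerm M (suc p)
        ≈⟨ +-congʳ (reflexive (≡.cong (λ t → signed t (M zero (inject₁ p) * det (suc n) (minor M (inject₁ p))))
                                      (Fin.toℕ-inject₁ p))) ⟩
      signed (toℕ p) (M zero (inject₁ p) * det (suc n) (minor M (inject₁ p))) + laplaceTerm M (suc p)
        ≈⟨ +-congʳ (signed-cong (toℕ p) (*-cong (M≈ zero) (det-cong (suc n) sameMinor))) ⟩
      signed (toℕ p) (M zero (suc p) * det (suc n) (minor M (suc p))) + laplaceTerm M (suc p)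
        ≈⟨ -‿inverseʳ _ ⟩
      0# ∎

  det-minor-adjacentEqualColumns n M p j ≢p ≢sp M≈ with punchOut-adjacent j p ≢p ≢sp
  det-minor-adjacentEqualColumns (suc n) M p j ≢p ≢sp M≈ | q , e₁ , e₂ =
    det-adjacentEqualColumns n (minor M j) q λ i →
      ≡.subst₂ (λ u v → M (suc i) u ≈ M (suc i) v) (≡.sym e₁) (≡.sym e₂) (M≈ (suc i))

  withAdjacentColumns : ∀ {n} → Fin (suc n) → (u v : Fin (suc (suc n)) → Carrier) →
    Matrix (suc (suc n)) → Matrix (suc (suc n))
  withAdjacentColumns p u v M = replaceColumn (suc p) v (replaceColumn (inject₁ p) u M)

  module _ {n} (p : Fin (suc n)) (M : Matrix (suc (suc n))) where

    withAdjacentColumns-left : ∀ u v i → withAdjacentColumns p u v M i (inject₁ p) ≈ u i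
    withAdjacentColumns-left u v i =
      trans (replaceColumn-off (suc p) v (replaceColumn (inject₁ p) u M) i (inject₁ p) (inject₁≢suc p))
            (replaceColumn-at (inject₁ p) u M i)

    withAdjacentColumns-right : ∀ u v i → withAdjacentColumns p u v M i (suc p) ≈ v i
    withAdjacentColumns-right u v i = replaceColumn-at (suc p) v (replaceColumn (inject₁ p) u M) i

    withAdjacentColumns-off : ∀ u v i l → l ≢ inject₁ p → l ≢ suc p → withAdjacentColumns p u v M i l ≈ M i l
    withAdjacentColumns-off u v i l ≢p ≢sp =
      trans (replaceColumn-off (suc p) v (replaceColumn (inject₁ p) u M) i l ≢sp)
            (replaceColumn-off (inject₁ p) u M i l ≢p)

    withAdjacentColumns-own : ∀ i l → withAdjacentColumns p (column M (inject₁ p)) (column M (suc p)) M i l ≈ M i l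
    withAdjacentColumns-own i l with l Fin.≟ inject₁ p | l Fin.≟ suc p
    ... | yes ≡.refl | _          = withAdjacentColumns-left (column M (inject₁ p)) (column M (suc p)) i
    ... | no _       | yes ≡.refl = withAdjacentColumns-right (column M (inject₁ p)) (column M (suc p)) i
    ... | no ≢p      | no ≢sp     = withAdjacentColumns-off (column M (inject₁ p)) (column M (suc p)) i l ≢p ≢sp

    det-withAdjacentColumns-antisymmetric : ∀ u v →
      det (suc (suc n)) (withAdjacentColumns p u v M) ≈ - det (suc (suc n)) (withAdjacentColumns p v u M)
    det-withAdjacentColumns-antisymmetric u v = +-inverseˡ-unique _ _ (begin
      D u v + D v u                          ≈⟨ +-cong (+-identityˡ _) (+-identityʳ _) ⟨
      (0# + D u v) + (D v u + 0#)            ≈⟨ +-cong (+-congʳ (alternating u)) (+-congˡ (alternating v)) ⟨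
      (D u u + D u v) + (D v u + D v v)      ≈⟨ +-cong (additiveʳ u) (additiveʳ v) ⟨
      D u (u ⊞ v) + D v (u ⊞ v)              ≈⟨ additiveˡ (u ⊞ v) ⟨
      D (u ⊞ v) (u ⊞ v)                      ≈⟨ alternating (u ⊞ v) ⟩
      0#                                     ∎)
      where
      D : (Fin (suc (suc n)) → Carrier) → (Fin (suc (suc n)) → Carrier) → Carrier
      D x y = det (suc (suc n)) (withAdjacentColumns p x y M)
      _⊞_ : (Fin (suc (suc n)) → Carrier) → (Fin (suc (suc n)) → Carrier) → Fin (suc (suc n)) → Carrier
      (x ⊞ y) i = x i + y i
      W : (Fin (suc (suc n)) → Carrier) → (Fin (suc (suc n)) → Carrier) → Matrix (suc (suc n))
      W x y = withAdjacentColumns p x y M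
      alternating : ∀ x → D x x ≈ 0#
      alternating x = det-adjacentEqualColumns n (W x x) p λ i →
        trans (withAdjacentColumns-left x x i) (sym (withAdjacentColumns-right x x i))
      additiveˡ : ∀ y → D (u ⊞ v) y ≈ D u y + D v y
      additiveˡ y = det-additiveColumn (suc (suc n)) (inject₁ p) (W u y) (W v y) (W (u ⊞ v) y)
        (replaceColumn-preservesAgreement (suc p) (inject₁ p) y (replaceColumn-agreeOff (inject₁ p) (u ⊞ v) u M))
        (replaceColumn-preservesAgreement (suc p) (inject₁ p) y (replaceColumn-agreeOff (inject₁ p) (u ⊞ v) v M))
        λ i → trans (withAdjacentColumns-left (u ⊞ v) y i)
                (sym (+-cong (withAdjacentColumns-left u y i) (withAdjacentColumns-left v y i)))
      additiveʳ : ∀ x → D x (u ⊞ v) ≈ D x u + D x v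
      additiveʳ x = det-additiveColumn (suc (suc n)) (suc p) (W x u) (W x v) (W x (u ⊞ v))
        (replaceColumn-agreeOff (suc p) (u ⊞ v) u (replaceColumn (inject₁ p) x M))
        (replaceColumn-agreeOff (suc p) (u ⊞ v) v (replaceColumn (inject₁ p) x M))
        λ i → trans (withAdjacentColumns-right x (u ⊞ v) i)
                (sym (+-cong (withAdjacentColumns-right x u i) (withAdjacentColumns-right x v i)))

  -- Swapping columns q - 1 and q moves the repeated column one step left, decreasing d = toℕ q.
  det-equalColumns< : ∀ d n (M : Matrix (suc n)) (p q : Fin (suc n)) → toℕ q ≡ d → toℕ p < toℕ q →
    (∀ i → M i p ≈ M i q) → det (suc n) M ≈ 0#
  det-equalColumns< d n M p zero _ () _
  det-equalColumns< zero n M p (suc q) () _ _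
  det-equalColumns< (suc d) (suc n) M p (suc q) q≡d p<q Mp≈Mq with toℕ p ℕ.≟ toℕ q
  ... | yes p≡q = det-adjacentEqualColumns n M q λ i → ≡.subst (λ t → M i t ≈ M i (suc q)) p≡inject₁q (Mp≈Mq i)
    where
    p≡inject₁q : p ≡ inject₁ q
    p≡inject₁q = Fin.toℕ-injective (≡.trans p≡q (≡.sym (Fin.toℕ-inject₁ q)))
  ... | no p≢q = begin
    det (suc (suc n)) M                                   ≈⟨ det-cong (suc (suc n)) (withAdjacentColumns-own q M) ⟨
    det (suc (suc n)) (withAdjacentColumns q u v M)      ≈⟨ det-withAdjacentColumns-antisymmetric q M u v ⟩
    - det (suc (suc n)) M′
      ≈⟨ -‿cong (det-equalColumns< d (suc n) M′ p (inject₁ q) q′≡d p<q′ M′p≈M′q′) ⟩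
    - 0#                                                  ≈⟨ -0#≈0# ⟩
    0#                                                    ∎
    where
    u v : Fin (suc (suc n)) → Carrier
    u = column M (inject₁ q)
    v = column M (suc q)
    M′ : Matrix (suc (suc n))
    M′ = withAdjacentColumns q v u M
    q′≡d : toℕ (inject₁ q) ≡ d
    q′≡d = ≡.trans (Fin.toℕ-inject₁ q) (ℕ.suc-injective q≡d)
    p<q′ : toℕ p < toℕ (inject₁ q)
    p<q′ = ≡.subst (toℕ p <_) (≡.sym (Fin.toℕ-inject₁ q)) (ℕ.≤∧≢⇒< (ℕ.≤-pred p<q) p≢q)
    M′p≈M′q′ : ∀ i → M′ i p ≈ M′ i (inject₁ q)
    M′p≈M′q′ i = begin
      M′ i p           ≈⟨ withAdjacentColumns-off q M v u i p
                             (λ eq → p≢q (≡.trans (≡.cong toℕ eq) (Fin.toℕ-inject₁ q)))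
                             (λ eq → ℕ.<⇒≢ p<q (≡.cong toℕ eq)) ⟩
      M i p            ≈⟨ Mp≈Mq i ⟩
      v i              ≈⟨ withAdjacentColumns-left q M v u i ⟨
      M′ i (inject₁ q) ∎

  det-equalColumns : ∀ n (M : Matrix n) p q → p ≢ q → (∀ i → M i p ≈ M i q) → det n M ≈ 0#
  det-equalColumns (suc n) M p q p≢q Mp≈Mq with ℕ.<-cmp (toℕ p) (toℕ q)
  ... | tri< p<q _ _ = det-equalColumns< (toℕ q) n M p q ≡.refl p<q Mp≈Mq
  ... | tri≈ _ p≡q _ = ⊥-elim (p≢q (Fin.toℕ-injective p≡q))
  ... | tri> _ _ q<p = det-equalColumns< (toℕ p) n M q p ≡.refl q<p (λ i → sym (Mp≈Mq i))

  replaceColumn-own : ∀ {n} j (M : Matrix n) i l → replaceColumn j (column M j) M i l ≈ M i l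
  replaceColumn-own j M i l with l Fin.≟ j
  ... | yes ≡.refl = replaceColumn-at l (column M l) M i
  ... | no l≢j     = replaceColumn-off j (column M j) M i l l≢j

  det-columnCombination : ∀ n (M : Matrix n) j m (b : Fin m → Carrier) (w : Fin m → Fin n → Carrier) →
    det n (replaceColumn j (λ i → sumFin m (λ l → b l * w l i)) M) ≈
    sumFin m (λ l → b l * det n (replaceColumn j (w l) M))
  det-columnCombination n M j zero    b w = det-zeroColumn n _ j (replaceColumn-at j (λ _ → 0#) M)
  det-columnCombination n M j (suc m) b w = trans
    (det-linearColumn n j (b zero) 1# (replaceColumn j (w zero) M) (replaceColumn j rest M) (replaceColumn j total M)
      (replaceColumn-agreeOff j total (w zero) M) (replaceColumn-agreeOff j total rest M)
      λ i → begin
        replaceColumn j total M i j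
          ≈⟨ replaceColumn-at j total M i ⟩
        b zero * w zero i + rest i
          ≈⟨ +-cong (*-congˡ (replaceColumn-at j (w zero) M i)) (trans (*-identityˡ _) (replaceColumn-at j rest M i)) ⟨
        b zero * replaceColumn j (w zero) M i j + 1# * replaceColumn j rest M i j ∎)
    (+-congˡ (trans (*-identityˡ _) (det-columnCombination n M j m (λ l → b (suc l)) (λ l → w (suc l)))))
    where
    rest total : Fin n → Carrier
    rest i  = sumFin m (λ l → b (suc l) * w (suc l) i)
    total i = sumFin (suc m) (λ l → b l * w l i)

  det-cramer : ∀ n (M : Matrix n) (a : Fin n → Carrier) j → det n (replaceColumn j (λ i → a · M i) M) ≈ a j * det n M
  det-cramer n M a j = begin
    det n (replaceColumn j (λ i → a · M i) M)                   ≈⟨ det-columnCombination n M j n a (column M) ⟩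
    sumFin n (λ l → a l * det n (replaceColumn j (column M l) M)) ≈⟨ sumFin-single n _ j others ⟩
    a j * det n (replaceColumn j (column M j) M)                 ≈⟨ *-congˡ (det-cong n (replaceColumn-own j M)) ⟩
    a j * det n M                                                ∎
    where
    others : ∀ l → l ≢ j → a l * det n (replaceColumn j (column M l) M) ≈ 0#
    others l l≢j = trans (*-congˡ (det-equalColumns n _ j l (λ eq → l≢j (≡.sym eq))
      λ i → trans (replaceColumn-at j (column M l) M i) (sym (replaceColumn-off j (column M l) M i l l≢j)))) (zeroʳ _)

  cofactor : ∀ {n} → Matrix (suc n) → Fin (suc n) → Carrier
  cofactor {n} M l = signed (toℕ l) (det n (minor M l))

  det-firstRowExpansion : ∀ n (M : Matrix (suc n)) → det (suc n) M ≈ M zero · cofactor M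
  det-firstRowExpansion n M = sumFin-cong (suc n) λ l → signed-*ˡ (toℕ l) (M zero l) (det n (minor M l))

  det-kernelCofactor : ∀ n (M : Matrix (suc n)) (a : Fin (suc n) → Carrier) → (∀ r → a · M (suc r) ≈ 0#) →
    ∀ j → a j * det (suc n) M ≈ (a · M zero) * cofactor M j
  det-kernelCofactor n M a a⊥ j = begin
    a j * det (suc n) M                     ≈⟨ det-cramer (suc n) M a j ⟨
    det (suc n) Mₐ                          ≈⟨ sumFin-single (suc n) (laplaceTerm Mₐ) j others ⟩
    laplaceTerm Mₐ j                        ≈⟨ signed-cong (toℕ j) (*-cong (replaceColumn-at j (λ i → a · M i) M zero)
                                                 (det-cong n (minor-agreeOff j (replaceColumn-off j (λ i → a · M i) M)))) ⟩
    signed (toℕ j) ((a · M zero) * det n (minor M j)) ≈⟨ signed-*ˡ (toℕ j) _ _ ⟩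
    (a · M zero) * cofactor M j             ∎
    where
    Mₐ : Matrix (suc n)
    Mₐ = replaceColumn j (λ i → a · M i) M
    others : ∀ l → l ≢ j → laplaceTerm Mₐ l ≈ 0#
    others l l≢j = trans (signed-cong (toℕ l) (trans (*-congˡ minor≈0) (zeroʳ _))) (signed-0# (toℕ l))
      where
      minor≈0 : det n (minor Mₐ l) ≈ 0#
      minor≈0 = det-zeroColumn n (minor Mₐ l) (punchOut l≢j) λ r →
        trans (reflexive (≡.cong (Mₐ (suc r)) (Fin.punchIn-punchOut l≢j)))
              (trans (replaceColumn-at j (λ i → a · M i) M (suc r)) (a⊥ r))

  det-exchangeFirstRow : ∀ n (M : Matrix (suc n)) (a y : Fin (suc n) → Carrier) → (∀ r → a · M (suc r) ≈ 0#) →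
    det (suc n) M * (a · y) ≈ det (suc n) (y ∷ tail M) * (a · M zero)
  det-exchangeFirstRow n M a y a⊥ = begin
    det (suc n) M * (a · y)                               ≈⟨ sumFin-*ˡ (suc n) (det (suc n) M) (λ l → a l * y l) ⟨
    sumFin (suc n) (λ l → det (suc n) M * (a l * y l))    ≈⟨ sumFin-cong (suc n) term ⟩
    sumFin (suc n) (λ l → (a · M zero) * (y l * cofactor M l))
      ≈⟨ sumFin-*ˡ (suc n) (a · M zero) (λ l → y l * cofactor M l) ⟩
    (a · M zero) * (y · cofactor M)                       ≈⟨ *-congˡ (det-firstRowExpansion n (y ∷ tail M)) ⟨
    (a · M zero) * det (suc n) (y ∷ tail M)               ≈⟨ *-comm _ _ ⟩
    det (suc n) (y ∷ tail M) * (a · M zero)               ∎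
    where
    term : ∀ l → det (suc n) M * (a l * y l) ≈ (a · M zero) * (y l * cofactor M l)
    term l = begin
      det (suc n) M * (a l * y l)          ≈⟨ x∙yz≈z∙xy _ _ _ ⟩
      y l * (det (suc n) M * a l)          ≈⟨ *-congˡ (trans (*-comm _ _) (det-kernelCofactor n M a a⊥ l)) ⟩
      y l * ((a · M zero) * cofactor M l)  ≈⟨ x∙yz≈y∙xz _ _ _ ⟩
      (a · M zero) * (y l * cofactor M l)  ∎

module PowerSeries {c ℓ : Level} (F : Field c ℓ) where
  open Field F hiding (zero)
  open FieldDefs F

  zPow* : ℕ → Series → Series
  zPow* zero    f n       = f n
  zPow* (suc m) f zero    = 0#
  zPow* (suc m) f (suc n) = zPow* m f n

  zPow*-below : ∀ m f n → n < m → zPow* m f n ≈ 0#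
  zPow*-below (suc m) f zero    _         = refl
  zPow*-below (suc m) f (suc n) (s≤s n<m) = zPow*-below m f n n<m

  zPow*-shifted : ∀ m f i → zPow* m f (m ℕ.+ i) ≡ f i
  zPow*-shifted zero    f i = ≡.refl
  zPow*-shifted (suc m) f i = zPow*-shifted m f i

  zPow*-start : ∀ m f → zPow* m f m ≡ f 0
  zPow*-start zero    f = ≡.refl
  zPow*-start (suc m) f = zPow*-start m f

  zPow*-step : ∀ {f g h : Series} a b → f ≋ (onePlusZ* a g ⊕ bz²* b h) → ∀ m n →
    zPow* m f n ≈ (zPow* (suc m) g (suc n) + a * zPow* (suc m) g n) + b * zPow* (suc (suc m)) h n
  zPow*-step a b f≋ zero    zero          =
    trans (f≋ 0) (+-cong (sym (trans (+-congˡ (zeroʳ a)) (+-identityʳ _))) (sym (zeroʳ b)))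
  zPow*-step a b f≋ zero    (suc zero)    = trans (f≋ 1) (+-congˡ (sym (zeroʳ b)))
  zPow*-step a b f≋ zero    (suc (suc n)) = f≋ (suc (suc n))
  zPow*-step a b f≋ (suc m) zero          =
    sym (trans (+-cong (trans (+-congˡ (zeroʳ a)) (+-identityʳ _)) (zeroʳ b)) (+-identityʳ 0#))
  zPow*-step a b f≋ (suc m) (suc n)       = zPow*-step a b f≋ m n

module EuclideanRemainders {c ℓ : Level} (F : Field c ℓ) (s : ℕ → Field.Carrier F)
                           (E : FieldDefs.EuclidDivision F (FieldDefs.one F) (FieldDefs.σ F s)) where
  open Field F hiding (zero)
  open FieldDefs F
  open EuclidDivision E
  open PowerSeries F
  open FiniteSums F
  open Determinant F using (det-exchangeFirstRow)
  open import Algebra.Properties.Ring ring using (xyx⁻¹≈y; [y-z]x≈yx-zx; -0#≈0#)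
  open import Relation.Binary.Reasoning.Setoid setoid

  β⁻¹ : ℕ → Carrier
  β⁻¹ k = proj₁ (inverse (β k) (β≉0 k))

  nextRemainder : ℕ → Carrier → Carrier → Carrier → Carrier
  nextRemainder k u v w = β⁻¹ k * ((u - v) - α k * w)

  nextRemainder-cong : ∀ k {u u′ v v′ w w′} → u ≈ u′ → v ≈ v′ → w ≈ w′ →
    nextRemainder k u v w ≈ nextRemainder k u′ v′ w′
  nextRemainder-cong k u≈ v≈ w≈ = *-congˡ (+-cong (+-cong u≈ (-‿cong v≈)) (-‿cong (*-congˡ w≈)))

  nextRemainder-0# : ∀ k → nextRemainder k 0# 0# 0# ≈ 0#
  nextRemainder-0# k = trans
    (*-congˡ (trans (+-cong (-‿inverseʳ 0#) (trans (-‿cong (zeroʳ (α k))) -0#≈0#)) (+-identityʳ 0#)))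
    (zeroʳ (β⁻¹ k))

  nextRemainder-*ʳ : ∀ k u v w x → nextRemainder k u v w * x ≈ nextRemainder k (u * x) (v * x) (w * x)
  nextRemainder-*ʳ k u v w x = trans (*-assoc _ _ _) (*-congˡ (trans ([y-z]x≈yx-zx x _ _)
    (+-cong ([y-z]x≈yx-zx x u v) (-‿cong (*-assoc (α k) w x)))))

  sumFin-nextRemainder : ∀ k N (u v w : Fin N → Carrier) →
    sumFin N (λ l → nextRemainder k (u l) (v l) (w l)) ≈ nextRemainder k (sumFin N u) (sumFin N v) (sumFin N w)
  sumFin-nextRemainder k N u v w = begin
    sumFin N (λ l → β⁻¹ k * ((u l - v l) - α k * w l))        ≈⟨ sumFin-*ˡ N (β⁻¹ k) _ ⟩
    β⁻¹ k * sumFin N (λ l → (u l - v l) + - (α k * w l))     ≈⟨ *-congˡ (sumFin-+ N _ _) ⟩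
    β⁻¹ k * (sumFin N (λ l → u l - v l) + sumFin N (λ l → - (α k * w l)))
      ≈⟨ *-congˡ (+-cong (trans (sumFin-+ N _ _) (+-congˡ (sumFin-neg N v)))
                         (trans (sumFin-neg N _) (-‿cong (sumFin-*ˡ N (α k) w)))) ⟩
    nextRemainder k (sumFin N u) (sumFin N v) (sumFin N w)  ∎

  nextRemainder-unique : ∀ k {u p q x} → u ≈ (p + α k * q) + β k * x → x ≈ nextRemainder k u p q
  nextRemainder-unique k {u} {p} {q} {x} u≈ = begin
    x                              ≈⟨ *-identityˡ x ⟨
    1# * x                         ≈⟨ *-congʳ (trans (*-comm _ _) (proj₂ (inverse (β k) (β≉0 k)))) ⟨
    (β⁻¹ k * β k) * x              ≈⟨ *-assoc _ _ _ ⟩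
    β⁻¹ k * (β k * x)              ≈⟨ *-congˡ isolate ⟨
    nextRemainder k u p q          ∎
    where
    isolate : (u - p) - α k * q ≈ β k * x
    isolate = begin
      (u - p) - α k * q                              ≈⟨ +-congʳ (+-congʳ (trans u≈ (+-assoc _ _ _))) ⟩
      ((p + (α k * q + β k * x)) - p) - α k * q      ≈⟨ +-congʳ (xyx⁻¹≈y p _) ⟩
      (α k * q + β k * x) - α k * q                  ≈⟨ xyx⁻¹≈y _ _ ⟩
      β k * x                                        ∎

  zPow*-remainder : ∀ k m n → zPow* (suc (suc m)) (g (suc (suc k))) n ≈
    nextRemainder k (zPow* m (g k) n) (zPow* (suc m) (g (suc k)) (suc n)) (zPow* (suc m) (g (suc k)) n)
  zPow*-remainder k m n = nextRemainder-unique k (zPow*-step (α k) (β k) (step k) m n)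

  combinationS : ℕ → (ℕ → Carrier) → ℕ → Carrier
  combinationS N a n = sumBelow N (λ j → a j * σ s (n ℕ.+ j))

  combinationS-pad : ∀ N a n → a N ≈ 0# → combinationS (suc N) a n ≈ combinationS N a n
  combinationS-pad N a n aN≈0 = sumBelow-pad N (λ j → a j * σ s (n ℕ.+ j)) (trans (*-congʳ aN≈0) (zeroˡ _))

  shift : (ℕ → Carrier) → ℕ → Carrier
  shift a zero    = 0#
  shift a (suc j) = a j

  combinationS-shift : ∀ N a n → combinationS (suc N) (shift a) n ≈ combinationS N a (suc n)
  combinationS-shift N a n = trans (+-congʳ (zeroˡ _)) (trans (+-identityˡ _)
    (sumFin-cong N λ l → reflexive (≡.cong (λ t → a (toℕ l) * σ s t) (ℕ.+-suc n (toℕ l)))))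

  nextCoeffs : ℕ → (ℕ → Carrier) → (ℕ → Carrier) → ℕ → Carrier
  nextCoeffs k a b j = nextRemainder k (a j) (shift b j) (b j)

  combinationS-nextCoeffs : ∀ k N a b n → a N ≈ 0# → a (suc N) ≈ 0# → b (suc N) ≈ 0# →
    combinationS (suc (suc N)) (nextCoeffs k a b) n ≈
    nextRemainder k (combinationS N a n) (combinationS (suc N) b (suc n)) (combinationS (suc N) b n)
  combinationS-nextCoeffs k N a b n aN≈0 aN+1≈0 bN+1≈0 = begin
    combinationS (suc (suc N)) (nextCoeffs k a b) n
      ≈⟨ sumFin-cong (suc (suc N)) (λ l →
           nextRemainder-*ʳ k (a (toℕ l)) (shift b (toℕ l)) (b (toℕ l)) (S (toℕ l))) ⟩
    sumBelow (suc (suc N)) (λ j → nextRemainder k (a j * S j) (shift b j * S j) (b j * S j))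
      ≈⟨ sumFin-nextRemainder k (suc (suc N)) (weighted a) (weighted (shift b)) (weighted b) ⟩
    nextRemainder k (combinationS (suc (suc N)) a n) (combinationS (suc (suc N)) (shift b) n) (combinationS (suc (suc N)) b n)
      ≈⟨ nextRemainder-cong k (trans (combinationS-pad (suc N) a n aN+1≈0) (combinationS-pad N a n aN≈0))
                              (combinationS-shift (suc N) b n) (combinationS-pad (suc N) b n bN+1≈0) ⟩
    nextRemainder k (combinationS N a n) (combinationS (suc N) b (suc n)) (combinationS (suc N) b n) ∎
    where
    S : ℕ → Carrier
    S j = σ s (n ℕ.+ j)
    weighted : (ℕ → Carrier) → Fin (suc (suc N)) → Carrier
    weighted h l = h (toℕ l) * S (toℕ l)

  record Expansion (m : ℕ) : Set (c ⊔ ℓ) where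
    field
      coeff   : ℕ → Carrier
      degree  : ∀ j → m < j → coeff j ≈ 0#
      expands : ∀ n → zPow* m (g (suc m)) n ≈ combinationS (suc m) coeff n

  expansion₀ : Expansion 0
  expansion₀ = record { coeff = one ; degree = degree ; expands = expands }
    where
    degree : ∀ j → 0 < j → one j ≈ 0#
    degree (suc j) _ = refl
    expands : ∀ n → g 1 n ≈ combinationS 1 one n
    expands n = trans (g1 n) (sym (trans (+-identityʳ _)
      (trans (*-identityˡ _) (reflexive (≡.cong (σ s) (ℕ.+-identityʳ n))))))

  expansion₁ : Expansion 1
  expansion₁ = record { coeff = nextCoeffs 0 (λ _ → 0#) one ; degree = degree ; expands = expands }
    where
    degree : ∀ j → 1 < j → nextCoeffs 0 (λ _ → 0#) one j ≈ 0#
    degree (suc zero)    (s≤s ())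
    degree (suc (suc j)) _ = nextRemainder-0# 0
    -- z f₁ is read off the division step at degree n + 1, to which f₋₁ = 1 contributes nothing.
    expands : ∀ n → zPow* 1 (g 2) n ≈ combinationS 2 (nextCoeffs 0 (λ _ → 0#) one) n
    expands n = begin
      zPow* 2 (g 2) (suc n)
        ≈⟨ zPow*-remainder 0 0 (suc n) ⟩
      nextRemainder 0 (g 0 (suc n)) (g 1 (suc n)) (g 1 n)
        ≈⟨ nextRemainder-cong 0 (g0 (suc n)) (Expansion.expands expansion₀ (suc n)) (Expansion.expands expansion₀ n) ⟩
      nextRemainder 0 0# (combinationS 1 one (suc n)) (combinationS 1 one n)
        ≈⟨ combinationS-nextCoeffs 0 0 (λ _ → 0#) one n refl refl refl ⟨
      combinationS 2 (nextCoeffs 0 (λ _ → 0#) one) n ∎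

  expansion-step : ∀ m → Expansion m → Expansion (suc m) → Expansion (suc (suc m))
  expansion-step m A B = record { coeff = nextCoeffs (suc m) A.coeff B.coeff ; degree = degree ; expands = expands }
    where
    module A = Expansion A
    module B = Expansion B
    degree : ∀ j → suc (suc m) < j → nextCoeffs (suc m) A.coeff B.coeff j ≈ 0#
    degree (suc j) m+2<j+1 = trans
      (nextRemainder-cong (suc m) (A.degree (suc j) (ℕ.<-trans (ℕ.n<1+n m) m+1<j+1)) (B.degree j (ℕ.≤-pred m+2<j+1))
                                  (B.degree (suc j) m+1<j+1))
      (nextRemainder-0# (suc m))
      where
      m+1<j+1 : suc m < suc j
      m+1<j+1 = ℕ.<-trans (ℕ.n<1+n (suc m)) m+2<j+1
    expands : ∀ n → zPow* (suc (suc m)) (g (suc (suc (suc m)))) n ≈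
                    combinationS (suc (suc (suc m))) (nextCoeffs (suc m) A.coeff B.coeff) n
    expands n = begin
      zPow* (suc (suc m)) (g (suc (suc (suc m)))) n
        ≈⟨ zPow*-remainder (suc m) m n ⟩
      nextRemainder (suc m) (zPow* m (g (suc m)) n) (zPow* (suc m) (g (suc (suc m))) (suc n)) (zPow* (suc m) (g (suc (suc m))) n)
        ≈⟨ nextRemainder-cong (suc m) (A.expands n) (B.expands (suc n)) (B.expands n) ⟩
      nextRemainder (suc m) (combinationS (suc m) A.coeff n)
        (combinationS (suc (suc m)) B.coeff (suc n)) (combinationS (suc (suc m)) B.coeff n)
        ≈⟨ combinationS-nextCoeffs (suc m) (suc m) A.coeff B.coeff n
             (A.degree (suc m) (ℕ.n<1+n m)) (A.degree (suc (suc m)) (ℕ.<-trans (ℕ.n<1+n m) (ℕ.n<1+n (suc m))))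
             (B.degree (suc (suc m)) (ℕ.n<1+n (suc m))) ⟨
      combinationS (suc (suc (suc m))) (nextCoeffs (suc m) A.coeff B.coeff) n ∎

  expansion : ∀ m → Expansion m
  expansion m = proj₁ (consecutive m)
    where
    consecutive : ∀ m → Expansion m × Expansion (suc m)
    consecutive zero    = expansion₀ , expansion₁
    consecutive (suc m) = let A , B = consecutive m in B , expansion-step m A B

  Sℤ-rowEntry : ∀ p q r → r ≤ p → Sℤ s ((+ p ℤ.+ + q) ℤ.- + r) ≡ σ s ((p ∸ r) ℕ.+ q)
  Sℤ-rowEntry p q r r≤p = ≡.cong (Sℤ s) (≡.trans (ℤ.m-n≡m⊖n (p ℕ.+ q) r)
    (≡.trans (ℤ.⊖-≥ (ℕ.≤-trans r≤p (ℕ.m≤m+n p q))) (≡.cong +_ (ℕ.+-∸-comm q r≤p))))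

  schur-rect*remainder≈schur-hook : ∀ k i → schur s (suc k) (rect k) * g (suc k) i ≈ schur s (suc k) (hook k i)
  schur-rect*remainder≈schur-hook k i = begin
    det (suc k) R * g (suc k) i                     ≈⟨ *-congˡ hookRow-dot ⟨
    det (suc k) R * (a · hookRow)                   ≈⟨ det-exchangeFirstRow k R a hookRow a⊥ ⟩
    det (suc k) (hookRow ∷ tail R) * (a · R zero)   ≈⟨ *-congˡ firstRow-dot ⟩
    schur s (suc k) (hook k i) * 1#                 ≈⟨ *-identityʳ _ ⟩
    schur s (suc k) (hook k i)                      ∎
    where
    open Expansion (expansion k)
    f : Series
    f = g (suc k)
    R : Fin (suc k) → Fin (suc k) → Carrier
    R r l = Sℤ s ((+ rect k r ℤ.+ + toℕ l) ℤ.- + toℕ r)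
    -- hook k i differs from rect k only in its first part, so hookRow ∷ tail R is,
    -- definitionally, the matrix of schur s (suc k) (hook k i).
    hookRow : Fin (suc k) → Carrier
    hookRow l = Sℤ s ((+ (k ℕ.+ i) ℤ.+ + toℕ l) ℤ.- + 0)
    a : Fin (suc k) → Carrier
    a l = coeff (toℕ l)
    row-dot : ∀ p r → r ≤ p → a · (λ l → Sℤ s ((+ p ℤ.+ + toℕ l) ℤ.- + r)) ≈ zPow* k f (p ∸ r)
    row-dot p r r≤p = trans (sumFin-cong (suc k) λ l → *-congˡ {a l} (reflexive (Sℤ-rowEntry p (toℕ l) r r≤p)))
                            (sym (expands (p ∸ r)))
    a⊥ : ∀ r → a · R (suc r) ≈ 0#
    a⊥ r = trans (row-dot k (suc (toℕ r)) (Fin.toℕ<n r))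
                 (zPow*-below k f (k ∸ suc (toℕ r)) (ℕ.∸-monoʳ-< (s≤s z≤n) (Fin.toℕ<n r)))
    firstRow-dot : a · R zero ≈ 1#
    firstRow-dot = trans (row-dot k 0 z≤n) (trans (reflexive (zPow*-start k f)) (unitary (suc k)))
    hookRow-dot : a · hookRow ≈ f i
    hookRow-dot = trans (row-dot (k ℕ.+ i) 0 z≤n) (reflexive (zPow*-shifted k f i))

mainTheorem2 : ∀ {c ℓ : Level} (F : Field c ℓ) →
    (s : ℕ → Field.Carrier F) →
    (E : FieldDefs.EuclidDivision F (FieldDefs.one F) (FieldDefs.σ F s)) →
    ∀ (k : ℕ) → k ≥ 1 → ∀ (i : ℕ) →
      Field._≈_ F
        (Field._*_ F (FieldDefs.schur F s (suc k) (FieldDefs.rect F k))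
                     (FieldDefs.EuclidDivision.g E (suc k) i))
        (FieldDefs.schur F s (suc k) (FieldDefs.hook F k i))
-- The identity also holds for k = 0.
mainTheorem2 F s E k _ i = EuclideanRemainders.schur-rect*remainder≈schur-hook F s E k i
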